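{- For all integers $m,n\geq 0$, the lattice $\mathbf{W}(m,n)$ is interval-constructable.
   Context: An $(m,n)$-word is a word $\mathfrak{w}=w_1w_2\cdots w_n$ of length $n$ over the alphabet $\{0,1,\dots,m+1\}$ such that (MN1) $w_1\neq m+1$, and (MN2) for every $s$ with $1\le s\le m$ and every index $i$, if $w_i=s$ then $w_j\ge s$ for all $j<i$. $\mathbf{W}(m,n)$ is the set of $(m,n)$-words ordered componentwise ($\mathfrak{u}\le\mathfrak{v}$ iff $u_i\le v_i$ for all $i$); this is a lattice. For a poset $\mathbf{P}=(P,\le)$ and an interval $X=[p,q]\subseteq P$, let $P_{\le X}=\{x\in P: x\le y\text{ for some }y\in X\}$; the doubling of $\mathbf{P}$ by $X$ is the subposet of $\mathbf{P}\times\mathbf{2}$ (with $\mathbf 2$ the chain $1<2$, product order componentwise) induced on $(P_{\le X}\times\{1\})\cup(((P\setminus P_{\le X})\cup X)\times\{2\})$. A finite lattice is interval-constructable if it is isomorphic to a lattice obtained from the one-element lattice by a finite (possibly empty) sequence of interval doublings. -}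

module Defs where

open import Data.Nat using (ℕ; zero; suc; _+_; _<_) renaming (_≤_ to _≤ℕ_)
open import Data.Fin using (Fin; toℕ)
open import Data.Bool using (Bool; true; false) renaming (_≤_ to _≤B_)
open import Data.Unit using (⊤)
open import Data.Product using (Σ; _×_; _,_; ∃)
open import Data.Sum using (_⊎_)
open import Relation.Nullary using (¬_)
open import Relation.Binary.PropositionalEquality using (_≡_; _≢_)

record FPoset : Set₁ where
  field
    Carrier : Set
    _≼_     : Carrier → Carrier → Set
open FPoset public

Word : ℕ → ℕ → Set
Word m n = Fin n → Fin (suc (suc m))

-- (MN1) w₁ ≠ m+1 ; (MN2) if w_i = s with 1 ≤ s ≤ m then w_j ≥ s for all j < i
IsMNWord : (m n : ℕ) → Word m n → Set
IsMNWord m n w =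
  ((i : Fin n) → toℕ i ≡ 0 → toℕ (w i) ≢ suc m)
  × ((i j : Fin n) → toℕ j < toℕ i → 1 ≤ℕ toℕ (w i) → toℕ (w i) ≤ℕ m
       → toℕ (w i) ≤ℕ toℕ (w j))

W : ℕ → ℕ → FPoset
W m n = record
  { Carrier = Σ (Word m n) (IsMNWord m n)
  ; _≼_ = λ u v → (i : Fin n) → toℕ (Σ.proj₁ u i) ≤ℕ toℕ (Σ.proj₁ v i)
  }

module _ (P : FPoset) where
  private
    C = Carrier P
    _≤P_ = _≼_ P

  InDown : C → C → C → Set
  InDown p q x = ∃ λ y → (p ≤P y × y ≤P q) × x ≤P y

  -- membership in the doubled poset at level b (false = 1, true = 2 of the chain 𝟐)
  InDouble : C → C → C → Bool → Set
  InDouble p q x false = InDown p q x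
  InDouble p q x true  = (¬ InDown p q x) ⊎ (p ≤P x × x ≤P q)

  Double : C → C → FPoset
  Double p q = record
    { Carrier = Σ (C × Bool) (λ xb → InDouble p q (Σ.proj₁ xb) (Σ.proj₂ xb))
    ; _≼_ = λ u v → (Σ.proj₁ (Σ.proj₁ u) ≤P Σ.proj₁ (Σ.proj₁ v))
                    × (Σ.proj₂ (Σ.proj₁ u) ≤B Σ.proj₂ (Σ.proj₁ v))
    }

One : FPoset
One = record { Carrier = ⊤ ; _≼_ = λ _ _ → ⊤ }

data Doubled : FPoset → Set₁ where
  base : Doubled One
  step : ∀ {P} → Doubled P → (p q : Carrier P) → _≼_ P p q → Doubled (Double P p q)

record OrderIso (A B : FPoset) : Set where
  field
    f        : Carrier A → Carrier B
    mono     : ∀ x y → _≼_ A x y → _≼_ B (f x) (f y)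
    reflect  : ∀ x y → _≼_ B (f x) (f y) → _≼_ A x y
    onto     : ∀ b → ∃ λ a → _≼_ B (f a) b × _≼_ B b (f a)

IntervalConstructable : FPoset → Set₁
IntervalConstructable L = ∃ λ (P : FPoset) → Doubled P × OrderIso L P

-- Deleting the last letter identifies W(m,n+1) with the pairs (u, x) of a word u ∈ W(m,n) and a
-- letter x admissible after u (x ≤ m with x ≤ every letter of u when x ≥ 1, or x = m+1 when n > 0).
-- Admit the values of x one at a time, in the order 0, m+1, 1, 2, …, m.  Admitting m+1 doubles
-- the whole of W(m,n); admitting k+1 ≤ m doubles the interval between (the constant word k+1, k)
-- and (top, k), whose words are exactly those allowing k+1, with k+1 as the upper copy of k.
-- Since interval-constructability is invariant under isomorphism and preserved by doubling,
-- induction on n proves the theorem.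

module Submission where

open import Defs
open import Data.Nat using (ℕ; zero; suc; _<_; _≡ᵇ_; z≤n; s≤s) renaming (_≤_ to _≤ℕ_)
open import Data.Nat.Properties
  using ( ≤-refl; ≤-reflexive; ≤-trans; ≤-antisym; ≤-pred; <⇒≤; <⇒≱; n≤1+n; m≤n⇒m≤1+n
        ; 1+n≰n; 1+n≢n; <-irrefl; <-asym; <-cmp; m≤n⇒m<n∨m≡n)
open import Data.Fin using (Fin; toℕ; fromℕ; fromℕ<; inject₁; zero; suc)
open import Data.Fin.Properties using (toℕ<n; toℕ-fromℕ; toℕ-fromℕ<; toℕ-inject₁)
open import Data.Vec.Functional using (init; last)
open import Data.Bool using (Bool; true; false; T; not; f≤t; b≤b) renaming (_≤_ to _≤𝔹_)
import Data.Bool.Properties as 𝔹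
open import Data.Unit using (tt)
open import Data.Product using (Σ; _×_; _,_; ∃; proj₁; proj₂)
open import Data.Sum using (_⊎_; inj₁; inj₂)
open import Relation.Nullary using (contradiction)
open import Relation.Binary.Definitions using (Transitive; tri<; tri≈; tri>)
open import Relation.Binary.PropositionalEquality
  using (_≡_; _≢_; refl; sym; trans; cong; subst; subst₂)

Equivalent : (P : FPoset) → Carrier P → Carrier P → Set
Equivalent P x y = _≼_ P x y × _≼_ P y x

Double-trans : ∀ {P p q} → Transitive (_≼_ P) → Transitive (_≼_ (Double P p q))
Double-trans trans {(x , _) , _} {(y , _) , _} {(z , _) , _} (x≤y , a≤b) (y≤z , b≤c) =
  trans {x} {y} {z} x≤y y≤z , 𝔹.≤-trans a≤b b≤c

Doubled⇒trans : ∀ {P} → Doubled P → Transitive (_≼_ P)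
Doubled⇒trans base                               = λ _ _ → tt
Doubled⇒trans (step {P} d p q _) {x} {y} {z} = Double-trans {P} {p} {q} (Doubled⇒trans d) {x} {y} {z}

OrderIso-trans : ∀ {A B C} → Transitive (_≼_ C) → OrderIso A B → OrderIso B C → OrderIso A C
OrderIso-trans {A} {B} {C} trans g h = record
  { f       = λ a → H.f (G.f a)
  ; mono    = λ x y x≤y → H.mono _ _ (G.mono x y x≤y)
  ; reflect = λ x y fx≤fy → G.reflect x y (H.reflect _ _ fx≤fy)
  ; onto    = onto
  }
  where
  module G = OrderIso g
  module H = OrderIso h
  onto : ∀ c → ∃ λ a → Equivalent C (H.f (G.f a)) c
  onto c with H.onto c
  ... | b , hb≤c , c≤hb with G.onto b
  ...   | a , ga≤b , b≤ga = a , trans (H.mono _ _ ga≤b) hb≤c , trans c≤hb (H.mono _ _ b≤ga)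

InDown-≼ : ∀ {P p q x y} → Transitive (_≼_ P) → _≼_ P x y → InDown P p q y → InDown P p q x
InDown-≼ trans x≤y (z , z∈ , y≤z) = z , z∈ , trans x≤y y≤z

Double-map : ∀ {L P} (p q : Carrier L) → Transitive (_≼_ P) → (iso : OrderIso L P)
           → OrderIso (Double L p q) (Double P (OrderIso.f iso p) (OrderIso.f iso q))
Double-map {L} {P} p q trans iso = record
  { f       = f′
  ; mono    = λ { _ _ (x≤y , a≤b) → mono _ _ x≤y , a≤b }
  ; reflect = λ { _ _ (x≤y , a≤b) → reflect _ _ x≤y , a≤b }
  ; onto    = onto′
  }
  where
  open OrderIso iso
  push : ∀ {x} → InDown L p q x → InDown P (f p) (f q) (f x)
  push (y , (p≤y , y≤q) , x≤y) = f y , (mono _ _ p≤y , mono _ _ y≤q) , mono _ _ x≤y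
  pull : ∀ {x} → InDown P (f p) (f q) (f x) → InDown L p q x
  pull (y , (p≤y , y≤q) , x≤y) with onto y
  ... | a , fa≤y , y≤fa =
    a , (reflect _ _ (trans p≤y y≤fa) , reflect _ _ (trans fa≤y y≤q)) , reflect _ _ (trans x≤y y≤fa)
  image : ∀ x b → InDouble L p q x b → InDouble P (f p) (f q) (f x) b
  image x false x↓                 = push x↓
  image x true  (inj₁ x↓̸)          = inj₁ λ fx↓ → x↓̸ (pull fx↓)
  image x true  (inj₂ (p≤x , x≤q)) = inj₂ (mono _ _ p≤x , mono _ _ x≤q)
  preimage : ∀ {y} a → Equivalent P (f a) y → ∀ b → InDouble P (f p) (f q) y b → InDouble L p q a b
  preimage a (fa≤y , y≤fa) false y↓                 = pull (InDown-≼ trans fa≤y y↓)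
  preimage a (fa≤y , y≤fa) true  (inj₁ y↓̸)          = inj₁ λ a↓ → y↓̸ (InDown-≼ trans y≤fa (push a↓))
  preimage a (fa≤y , y≤fa) true  (inj₂ (p≤y , y≤q)) =
    inj₂ (reflect _ _ (trans p≤y y≤fa) , reflect _ _ (trans fa≤y y≤q))
  f′ : Carrier (Double L p q) → Carrier (Double P (f p) (f q))
  f′ ((x , b) , x∈) = (f x , b) , image x b x∈
  onto′ : ∀ c → ∃ λ a → Equivalent (Double P (f p) (f q)) (f′ a) c
  onto′ ((y , b) , y∈) with onto y
  ... | a , fa≤y , y≤fa = ((a , b) , preimage a (fa≤y , y≤fa) b y∈) , (fa≤y , b≤b) , (y≤fa , b≤b)

IntervalConstructable-resp : ∀ {A B} → OrderIso A B → IntervalConstructable B → IntervalConstructable A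
IntervalConstructable-resp A≅B (P , d , B≅P) = P , d , OrderIso-trans (Doubled⇒trans d) A≅B B≅P

IntervalConstructable-Double : ∀ {L} (p q : Carrier L) → _≼_ L p q
                             → IntervalConstructable L → IntervalConstructable (Double L p q)
IntervalConstructable-Double p q p≤q (P , d , L≅P) =
  Double P (f p) (f q) , step d (f p) (f q) (mono p q p≤q) , Double-map p q (Doubled⇒trans d) L≅P
  where open OrderIso L≅P

-- Splitting the letter values at a level

data Position (k : ℕ) : ℕ → Set where
  below  : ∀ {x} → x ≤ℕ k → Position k x
  next   : Position k (suc k)
  beyond : ∀ {x} → suc k < x → Position k x

position : ∀ k x → Position k x
position k x with <-cmp x (suc k)
... | tri< x<1+k _ _ = below (≤-pred x<1+k)
... | tri≈ _ refl _  = next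
... | tri> _ _ 1+k<x = beyond 1+k<x

collapse : ∀ {k x} → Position k x → ℕ
collapse {x = x} (below _)  = x
collapse {k}     next       = k
collapse {x = x} (beyond _) = x

isUpper : ∀ {k x} → Position k x → Bool
isUpper (below _)  = false
isUpper next       = true
isUpper (beyond _) = true

position-mono : ∀ {k x y} (c : Position k x) (c′ : Position k y) → x ≤ℕ y
              → collapse c ≤ℕ collapse c′ × isUpper c ≤𝔹 isUpper c′
position-mono (below _)     (below _)      x≤y   = x≤y , b≤b
position-mono (below x≤k)   next           _     = x≤k , f≤t
position-mono (below _)     (beyond _)     x≤y   = x≤y , f≤t
position-mono next          (below y≤k)    1+k≤y = contradiction (≤-trans 1+k≤y y≤k) 1+n≰n
position-mono next          next           _     = ≤-refl , b≤b
position-mono next          (beyond 1+k<y) _     = ≤-trans (n≤1+n _) (<⇒≤ 1+k<y) , b≤b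
position-mono (beyond 1+k<x) (below y≤k)   x≤y   = contradiction (≤-trans x≤y y≤k) (<⇒≱ (<⇒≤ 1+k<x))
position-mono (beyond 1+k<x) next          x≤1+k = contradiction x≤1+k (<⇒≱ 1+k<x)
position-mono (beyond _)    (beyond _)     x≤y   = x≤y , b≤b

position-reflect : ∀ {k x y} (c : Position k x) (c′ : Position k y)
                 → collapse c ≤ℕ collapse c′ → isUpper c ≤𝔹 isUpper c′ → x ≤ℕ y
position-reflect (below _)      (below _)      x≤y _ = x≤y
position-reflect (below x≤k)    next           _   _ = ≤-trans x≤k (n≤1+n _)
position-reflect (below _)      (beyond _)     x≤y _ = x≤y
position-reflect next           (below _)      _   ()
position-reflect next           next           _   _ = ≤-refl
position-reflect next           (beyond 1+k<y) _   _ = <⇒≤ 1+k<y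
position-reflect (beyond _)     (below _)      _   ()
position-reflect (beyond 1+k<x) next           x≤k _ = contradiction x≤k (<⇒≱ (<⇒≤ 1+k<x))
position-reflect (beyond _)     (beyond _)     x≤y _ = x≤y

position-irrelevant : ∀ {k x} (c c′ : Position k x) → collapse c ≡ collapse c′ × isUpper c ≡ isUpper c′
position-irrelevant (below _)      (below _)      = refl , refl
position-irrelevant next           next           = refl , refl
position-irrelevant (beyond _)     (beyond _)     = refl , refl
position-irrelevant (below 1+k≤k)  next           = contradiction 1+k≤k 1+n≰n
position-irrelevant next           (below 1+k≤k)  = contradiction 1+k≤k 1+n≰n
position-irrelevant (below x≤k)    (beyond 1+k<x) = contradiction x≤k (<⇒≱ (<⇒≤ 1+k<x))
position-irrelevant (beyond 1+k<x) (below x≤k)    = contradiction x≤k (<⇒≱ (<⇒≤ 1+k<x))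
position-irrelevant next           (beyond 1+k<1+k) = contradiction 1+k<1+k 1+n≰n
position-irrelevant (beyond 1+k<1+k) next         = contradiction 1+k<1+k 1+n≰n

_∷ʳ_ : ∀ {A : Set} {n} → (Fin n → A) → A → Fin (suc n) → A
_∷ʳ_ {n = zero}  u c _       = c
_∷ʳ_ {n = suc n} u c zero    = u zero
_∷ʳ_ {n = suc n} u c (suc i) = ((λ j → u (suc j)) ∷ʳ c) i

init-∷ʳ : ∀ {A : Set} {n} (u : Fin n → A) c i → init (u ∷ʳ c) i ≡ u i
init-∷ʳ {n = suc n} u c zero    = refl
init-∷ʳ {n = suc n} u c (suc i) = init-∷ʳ (λ j → u (suc j)) c i

last-∷ʳ : ∀ {A : Set} {n} (u : Fin n → A) c → last (u ∷ʳ c) ≡ c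
last-∷ʳ {n = zero}  u c = refl
last-∷ʳ {n = suc n} u c = last-∷ʳ (λ j → u (suc j)) c

data InitOrLast : ∀ {n} → Fin (suc n) → Set where
  initial : ∀ {n} (i : Fin n) → InitOrLast (inject₁ i)
  final   : ∀ {n} → InitOrLast (fromℕ n)

initOrLast : ∀ {n} (i : Fin (suc n)) → InitOrLast i
initOrLast {zero}  zero = final
initOrLast {suc n} zero = initial zero
initOrLast {suc n} (suc i) with initOrLast i
... | initial j = initial (suc j)
... | final     = final

module _ (m : ℕ) where

  MNWord : ℕ → Set
  MNWord n = Carrier (W m n)

  letter : ∀ {n} → MNWord n → Fin n → ℕ
  letter (w , _) i = toℕ (w i)

  _⊑_ : ∀ {n} → MNWord n → MNWord n → Set
  _⊑_ {n} = _≼_ (W m n)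

  ⊑-refl : ∀ {n} (u : MNWord n) → u ⊑ u
  ⊑-refl u i = ≤-refl

  letter≤1+m : ∀ {n} (u : MNWord n) i → letter u i ≤ℕ suc m
  letter≤1+m (w , _) i = ≤-pred (toℕ<n (w i))

  letter-of : ∀ {k} → k ≤ℕ suc m → Fin (suc (suc m))
  letter-of k≤1+m = fromℕ< (s≤s k≤1+m)

  toℕ-letter-of : ∀ {k} (k≤1+m : k ≤ℕ suc m) → toℕ (letter-of k≤1+m) ≡ k
  toℕ-letter-of k≤1+m = toℕ-fromℕ< (s≤s k≤1+m)

  constant : ∀ {n k} → k ≤ℕ m → MNWord n
  constant {k = k} k≤m = (λ _ → letter-of (m≤n⇒m≤1+n k≤m)) , mn1 , λ _ _ _ _ _ → ≤-refl
    where
    mn1 : ∀ i → toℕ i ≡ 0 → toℕ (letter-of (m≤n⇒m≤1+n k≤m)) ≢ suc m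
    mn1 _ _ c≡1+m = 1+n≰n (subst (_≤ℕ m) (trans (sym (toℕ-letter-of (m≤n⇒m≤1+n k≤m))) c≡1+m) k≤m)

  letter-constant : ∀ {n k} (k≤m : k ≤ℕ m) (i : Fin n) → letter (constant k≤m) i ≡ k
  letter-constant k≤m i = toℕ-letter-of (m≤n⇒m≤1+n k≤m)

  constant-least : ∀ {n} (u : MNWord n) → constant z≤n ⊑ u
  constant-least u i = subst (_≤ℕ letter u i) (sym (letter-constant z≤n i)) z≤n

  -- Only the first letter of a word is barred from being m+1.
  top-letter : ∀ {n} → Fin n → ℕ
  top-letter zero    = m
  top-letter (suc _) = suc m

  top-letter≤1+m : ∀ {n} (i : Fin n) → top-letter i ≤ℕ suc m
  top-letter≤1+m zero    = n≤1+n m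
  top-letter≤1+m (suc _) = ≤-refl

  top : ∀ {n} → MNWord n
  top = (λ i → letter-of (top-letter≤1+m i)) , mn1 , mn2
    where
    mn1 : ∀ {n} (i : Fin n) → toℕ i ≡ 0 → toℕ (letter-of (top-letter≤1+m i)) ≢ suc m
    mn1 zero _ m≡1+m = 1+n≢n (sym (trans (sym (toℕ-letter-of (n≤1+n m))) m≡1+m))
    mn2 : ∀ {n} (i j : Fin n) → toℕ j < toℕ i → 1 ≤ℕ toℕ (letter-of (top-letter≤1+m i))
        → toℕ (letter-of (top-letter≤1+m i)) ≤ℕ m
        → toℕ (letter-of (top-letter≤1+m i)) ≤ℕ toℕ (letter-of (top-letter≤1+m j))
    mn2 zero    _ () _ _
    mn2 (suc _) _ _ _ 1+m≤m = contradiction (subst (_≤ℕ m) (toℕ-letter-of (≤-refl {suc m})) 1+m≤m) 1+n≰n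

  letter-top : ∀ {n} (i : Fin n) → letter top i ≡ top-letter i
  letter-top i = toℕ-letter-of (top-letter≤1+m i)

  m≤letter-top : ∀ {n} (i : Fin n) → m ≤ℕ letter top i
  m≤letter-top i = subst (m ≤ℕ_) (sym (letter-top i)) (m≤top-letter i)
    where
    m≤top-letter : ∀ {n} (i : Fin n) → m ≤ℕ top-letter i
    m≤top-letter zero    = ≤-refl
    m≤top-letter (suc _) = n≤1+n m

  top-greatest : ∀ {n} (u : MNWord n) → u ⊑ top
  top-greatest u i = subst (letter u i ≤ℕ_) (sym (letter-top i)) (≤-top-letter u i)
    where
    ≤-top-letter : ∀ {n} (u : MNWord n) i → letter u i ≤ℕ top-letter i
    ≤-top-letter u@(_ , mn1 , _) zero with m≤n⇒m<n∨m≡n (letter≤1+m u zero)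
    ... | inj₁ u₀<1+m = ≤-pred u₀<1+m
    ... | inj₂ u₀≡1+m = contradiction u₀≡1+m (mn1 zero refl)
    ≤-top-letter u (suc i) = letter≤1+m u (suc i)

  -- Ext n t k stands for the words u x of length n + 1 whose last letter x is at most k,
  -- or is m+1 when t holds; t records whether MN1 permits x = m+1, i.e. whether n ≠ 0.
  record Admissible {n} (t : Bool) (k : ℕ) (u : MNWord n) (x : ℕ) : Set where
    constructor admissible
    field
      range    : x ≤ℕ k ⊎ (T t × x ≡ suc m)
      ≤letters : 1 ≤ℕ x → x ≤ℕ m → ∀ j → x ≤ℕ letter u j

  Ext : ℕ → Bool → ℕ → FPoset
  Ext n t k = record
    { Carrier = Σ (MNWord n × ℕ) λ (u , x) → Admissible t k u x
    ; _≼_     = λ ((u , x) , _) ((v , y) , _) → u ⊑ v × x ≤ℕ y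
    }

  Admissible-weaken : ∀ {n t k k′} {u : MNWord n} {x} → k ≤ℕ k′ → Admissible t k u x → Admissible t k′ u x
  Admissible-weaken k≤k′ (admissible (inj₁ x≤k) above) = admissible (inj₁ (≤-trans x≤k k≤k′)) above
  Admissible-weaken k≤k′ (admissible (inj₂ x≡1+m) above) = admissible (inj₂ x≡1+m) above

  Admissible⇒≤1+m : ∀ {n t k} {u : MNWord n} {x} → k ≤ℕ m → Admissible t k u x → x ≤ℕ suc m
  Admissible⇒≤1+m k≤m (admissible (inj₁ x≤k) _)         = m≤n⇒m≤1+n (≤-trans x≤k k≤m)
  Admissible⇒≤1+m k≤m (admissible (inj₂ (_ , refl)) _) = ≤-refl

  Ext-false-0≅W : ∀ {n} → OrderIso (Ext n false 0) (W m n)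
  Ext-false-0≅W {n} = record
    { f       = λ ((u , _) , _) → u
    ; mono    = λ _ _ (u⊑v , _) → u⊑v
    ; reflect = reflect
    ; onto    = λ u → ((u , 0) , admissible (inj₁ z≤n) λ ()) , ⊑-refl u , ⊑-refl u
    }
    where
    reflect : ∀ (e e′ : Carrier (Ext n false 0)) → proj₁ (proj₁ e) ⊑ proj₁ (proj₁ e′)
            → _≼_ (Ext n false 0) e e′
    reflect (_ , admissible (inj₁ x≤0) _) _ u⊑v = u⊑v , ≤-trans x≤0 z≤n

  Ext-true-0≅Double : ∀ {n} → OrderIso (Ext n true 0) (Double (W m n) (constant z≤n) top)
  Ext-true-0≅Double {n} = record { f = f ; mono = mono ; reflect = reflect ; onto = onto }
    where
    E D : FPoset
    E = Ext n true 0
    D = Double (W m n) (constant z≤n) top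
    f : Carrier E → Carrier D
    f ((u , zero)  , _) = (u , false) , top , (constant-least top , ⊑-refl top) , top-greatest u
    f ((u , suc _) , _) = (u , true) , inj₂ (constant-least u , top-greatest u)
    level-1+m : ∀ {u : MNWord n} {x} → Admissible true 0 u (suc x) → suc x ≡ suc m
    level-1+m (admissible (inj₂ (_ , 1+x≡1+m)) _) = 1+x≡1+m
    mono : ∀ e e′ → _≼_ E e e′ → _≼_ D (f e) (f e′)
    mono ((_ , zero)  , _) ((_ , zero)  , _) (u⊑v , _) = u⊑v , b≤b
    mono ((_ , zero)  , _) ((_ , suc _) , _) (u⊑v , _) = u⊑v , f≤t
    mono ((_ , suc _) , _) ((_ , zero)  , _) (_ , ())
    mono ((_ , suc _) , _) ((_ , suc _) , _) (u⊑v , _) = u⊑v , b≤b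
    reflect : ∀ e e′ → _≼_ D (f e) (f e′) → _≼_ E e e′
    reflect ((_ , zero)  , _) ((_ , zero)  , _) (u⊑v , _) = u⊑v , z≤n
    reflect ((_ , zero)  , _) ((_ , suc _) , _) (u⊑v , _) = u⊑v , z≤n
    reflect ((_ , suc _) , _) ((_ , zero)  , _) (_ , ())
    reflect ((u , suc _) , a) ((v , suc _) , a′) (u⊑v , _) =
      u⊑v , ≤-reflexive (trans (level-1+m {u} a) (sym (level-1+m {v} a′)))
    onto : ∀ d → ∃ λ e → Equivalent D (f e) d
    onto ((u , false) , _) = ((u , 0) , admissible (inj₁ z≤n) λ ()) , (⊑-refl u , b≤b) , (⊑-refl u , b≤b)
    onto ((u , true)  , _) =
      ((u , suc m) , admissible (inj₂ (tt , refl)) λ _ 1+m≤m → contradiction 1+m≤m 1+n≰n)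
      , (⊑-refl u , b≤b) , (⊑-refl u , b≤b)

  module NextLevel (n : ℕ) (t : Bool) (k : ℕ) (1+k≤m : suc k ≤ℕ m) where
    E E′ : FPoset
    E  = Ext n t k
    E′ = Ext n t (suc k)

    p q : Carrier E
    p = (constant 1+k≤m , k) , admissible (inj₁ ≤-refl) λ _ _ j →
          subst (k ≤ℕ_) (sym (letter-constant 1+k≤m j)) (n≤1+n k)
    q = (top , k) , admissible (inj₁ ≤-refl) λ _ k≤m j → ≤-trans k≤m (m≤letter-top j)

    p≤q : _≼_ E p q
    p≤q = top-greatest (constant 1+k≤m) , ≤-refl

    D : FPoset
    D = Double E p q

    low⇒down : ∀ {u : MNWord n} {x} (a : Admissible t k u x) → x ≤ℕ k → InDown E p q ((u , x) , a)
    low⇒down {u} _ x≤k = q , (p≤q , ⊑-refl top , ≤-refl) , top-greatest u , x≤k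

    down⇒low : ∀ {u : MNWord n} {x} (a : Admissible t k u x) → InDown E p q ((u , x) , a) → x ≤ℕ k
    down⇒low _ (_ , (_ , (_ , y≤k)) , (_ , x≤y)) = ≤-trans x≤y y≤k

    constant⊑ : ∀ {u : MNWord n} → Admissible t (suc k) u (suc k) → constant 1+k≤m ⊑ u
    constant⊑ {u} (admissible _ above) i =
      subst (_≤ℕ letter u i) (sym (letter-constant 1+k≤m i)) (above (s≤s z≤n) 1+k≤m i)

    collapse-admissible : ∀ {u : MNWord n} {x} → Admissible t (suc k) u x → (c : Position k x)
                        → Admissible t k u (collapse c)
    collapse-admissible (admissible _ above) (below x≤k) = admissible (inj₁ x≤k) above
    collapse-admissible (admissible _ above) next =
      admissible (inj₁ ≤-refl) λ _ _ j → ≤-trans (n≤1+n k) (above (s≤s z≤n) 1+k≤m j)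
    collapse-admissible (admissible (inj₁ x≤1+k) _) (beyond 1+k<x) = contradiction x≤1+k (<⇒≱ 1+k<x)
    collapse-admissible (admissible (inj₂ x≡1+m) above) (beyond _) = admissible (inj₂ x≡1+m) above

    collapse-∈ : ∀ {u : MNWord n} {x} (a : Admissible t (suc k) u x) (c : Position k x)
               → InDouble E p q ((u , collapse c) , collapse-admissible a c) (isUpper c)
    collapse-∈ {u} (admissible _ above) (below x≤k) = low⇒down {u} (admissible (inj₁ x≤k) above) x≤k
    collapse-∈ {u} a next = inj₂ ((constant⊑ {u} a , ≤-refl) , (top-greatest u , ≤-refl))
    collapse-∈ (admissible (inj₁ x≤1+k) _) (beyond 1+k<x) = contradiction x≤1+k (<⇒≱ 1+k<x)
    collapse-∈ {u} (admissible (inj₂ x≡1+m) above) (beyond 1+k<x) =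
      inj₁ λ x↓ → contradiction (down⇒low {u} (admissible (inj₂ x≡1+m) above) x↓) (<⇒≱ (<⇒≤ 1+k<x))

    image : ∀ {u : MNWord n} {x} → Admissible t (suc k) u x → Position k x → Carrier D
    image {u} a c = (((u , collapse c) , collapse-admissible {u} a c) , isUpper c) , collapse-∈ {u} a c

    image-≈ : ∀ {u : MNWord n} {x y b} (a : Admissible t (suc k) u x)
              (a′ : Admissible t k u y) (y∈ : InDouble E p q ((u , y) , a′) b) (c : Position k x)
            → collapse c ≡ y → isUpper c ≡ b
            → Equivalent D (image {u} a (position k x)) ((((u , y) , a′) , b) , y∈)
    image-≈ {u} {x} _ _ _ c refl refl with position-irrelevant (position k x) c
    ... | collapse≡ , isUpper≡ = ((⊑-refl u , ≤-reflexive collapse≡) , 𝔹.≤-reflexive isUpper≡)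
                               , ((⊑-refl u , ≤-reflexive (sym collapse≡)) , 𝔹.≤-reflexive (sym isUpper≡))

    Ext-suc≅Double : OrderIso E′ D
    Ext-suc≅Double = record { f = f ; mono = mono ; reflect = reflect ; onto = onto }
      where
      f : Carrier E′ → Carrier D
      f ((u , x) , a) = image {u} a (position k x)
      mono : ∀ e e′ → _≼_ E′ e e′ → _≼_ D (f e) (f e′)
      mono ((_ , x) , _) ((_ , y) , _) (u⊑v , x≤y) =
        let c≤c′ , b≤b′ = position-mono (position k x) (position k y) x≤y in (u⊑v , c≤c′) , b≤b′
      reflect : ∀ e e′ → _≼_ D (f e) (f e′) → _≼_ E′ e e′
      reflect ((_ , x) , _) ((_ , y) , _) ((u⊑v , c≤c′) , b≤b′) =
        u⊑v , position-reflect (position k x) (position k y) c≤c′ b≤b′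
      onto : ∀ d → ∃ λ e → Equivalent D (f e) d
      onto ((((u , y) , a) , false) , y↓) =
        ((u , y) , a⁺) , image-≈ {u} a⁺ a y↓ (below (down⇒low {u} a y↓)) refl refl
        where
        a⁺ : Admissible t (suc k) u y
        a⁺ = Admissible-weaken (n≤1+n k) a
      onto ((((u , y) , a) , true) , y∈@(inj₂ (p≤e , e≤q))) =
        ((u , suc k) , a⁺) , image-≈ {u} a⁺ a y∈ next (≤-antisym (proj₂ p≤e) (proj₂ e≤q)) refl
        where
        a⁺ : Admissible t (suc k) u (suc k)
        a⁺ = admissible (inj₁ ≤-refl) λ _ _ j →
               subst (_≤ℕ letter u j) (letter-constant 1+k≤m j) (proj₁ p≤e j)
      onto ((((u , y) , a@(admissible (inj₁ y≤k) _)) , true) , inj₁ y↓̸) =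
        contradiction (low⇒down {u} a y≤k) y↓̸
      onto ((((u , _) , a@(admissible (inj₂ (_ , refl)) _)) , true) , y∈@(inj₁ _)) =
        ((u , suc m) , a⁺) , image-≈ {u} a⁺ a y∈ (beyond (s≤s 1+k≤m)) refl refl
        where
        a⁺ : Admissible t (suc k) u (suc m)
        a⁺ = Admissible-weaken (n≤1+n k) a

  Ext-IC : ∀ n t k → k ≤ℕ m → IntervalConstructable (W m n) → IntervalConstructable (Ext n t k)
  Ext-IC n false zero    _     W-IC = IntervalConstructable-resp Ext-false-0≅W W-IC
  Ext-IC n true  zero    _     W-IC =
    IntervalConstructable-resp Ext-true-0≅Double
      (IntervalConstructable-Double _ _ (top-greatest (constant z≤n)) W-IC)
  Ext-IC n t     (suc k) 1+k≤m W-IC =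
    IntervalConstructable-resp Ext-suc≅Double
      (IntervalConstructable-Double p q p≤q (Ext-IC n t k (<⇒≤ 1+k≤m) W-IC))
    where open NextLevel n t k 1+k≤m

  initW : ∀ {n} → MNWord (suc n) → MNWord n
  initW (w , mn1 , mn2) = init w , mn1′ , mn2′
    where
    mn1′ : ∀ i → toℕ i ≡ 0 → toℕ (init w i) ≢ suc m
    mn1′ i i≡0 = mn1 (inject₁ i) (trans (toℕ-inject₁ i) i≡0)
    mn2′ : ∀ i j → toℕ j < toℕ i → 1 ≤ℕ toℕ (init w i) → toℕ (init w i) ≤ℕ m
         → toℕ (init w i) ≤ℕ toℕ (init w j)
    mn2′ i j j<i = mn2 (inject₁ i) (inject₁ j) (subst₂ _<_ (sym (toℕ-inject₁ j)) (sym (toℕ-inject₁ i)) j<i)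

  inject₁<fromℕ : ∀ {n} (j : Fin n) → toℕ (inject₁ j) < toℕ (fromℕ n)
  inject₁<fromℕ {n} j = subst₂ _<_ (sym (toℕ-inject₁ j)) (sym (toℕ-fromℕ n)) (toℕ<n j)

  last-admissible : ∀ {n} (w : MNWord (suc n)) → Admissible (not (n ≡ᵇ 0)) m (initW w) (letter w (fromℕ n))
  last-admissible {n} w@(w′ , mn1 , mn2) =
    admissible range λ 1≤x x≤m j → mn2 (fromℕ n) (inject₁ j) (inject₁<fromℕ j) 1≤x x≤m
    where
    -- When n = 0 the last letter is also the first one, so MN1 bars it from being m+1.
    top⇒nonzero : ∀ n (w : MNWord (suc n)) → letter w (fromℕ n) ≡ suc m → T (not (n ≡ᵇ 0))
    top⇒nonzero zero    (_ , mn1 , _) = mn1 zero refl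
    top⇒nonzero (suc _) _             = λ _ → tt
    range : toℕ (last w′) ≤ℕ m ⊎ (T (not (n ≡ᵇ 0)) × toℕ (last w′) ≡ suc m)
    range with m≤n⇒m<n∨m≡n (letter≤1+m w (fromℕ n))
    ... | inj₁ x<1+m = inj₁ (≤-pred x<1+m)
    ... | inj₂ x≡1+m = inj₂ (top⇒nonzero n w x≡1+m , x≡1+m)

  appendW : ∀ {n} (u : MNWord n) {x} → Admissible (not (n ≡ᵇ 0)) m u x → MNWord (suc n)
  appendW {n} (u , mn1 , mn2) {x} a@(admissible range ≤letters) =
    w , (λ i → mn1′ i (initOrLast i)) , λ i j → mn2′ i j (initOrLast i) (initOrLast j)
    where
    c : Fin (suc (suc m))
    c = letter-of (Admissible⇒≤1+m ≤-refl a)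
    w : Word m (suc n)
    w = u ∷ʳ c
    c≡x : toℕ c ≡ x
    c≡x = toℕ-letter-of (Admissible⇒≤1+m ≤-refl a)
    not-top : ∀ {n} → n ≡ 0 → x ≤ℕ m ⊎ (T (not (n ≡ᵇ 0)) × x ≡ suc m) → x ≢ suc m
    not-top _    (inj₁ x≤m) x≡1+m = 1+n≰n (subst (_≤ℕ m) x≡1+m x≤m)
    not-top refl (inj₂ (() , _))
    mn1′ : ∀ i → InitOrLast i → toℕ i ≡ 0 → toℕ (w i) ≢ suc m
    mn1′ _ (initial j) j≡0 rewrite init-∷ʳ u c j = mn1 j (trans (sym (toℕ-inject₁ j)) j≡0)
    mn1′ _ final       n≡0 rewrite last-∷ʳ u c | c≡x = not-top (trans (sym (toℕ-fromℕ n)) n≡0) range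
    mn2′ : ∀ i j → InitOrLast i → InitOrLast j → toℕ j < toℕ i → 1 ≤ℕ toℕ (w i) → toℕ (w i) ≤ℕ m
         → toℕ (w i) ≤ℕ toℕ (w j)
    mn2′ _ _ (initial i) (initial j) j<i rewrite init-∷ʳ u c i | init-∷ʳ u c j =
      mn2 i j (subst₂ _<_ (toℕ-inject₁ j) (toℕ-inject₁ i) j<i)
    mn2′ _ _ final (initial j) _ 1≤x x≤m rewrite last-∷ʳ u c | init-∷ʳ u c j | c≡x = ≤letters 1≤x x≤m j
    mn2′ _ _ (initial i) final n<i = contradiction (inject₁<fromℕ i) (<-asym n<i)
    mn2′ _ _ final final n<n = contradiction n<n (<-irrefl refl)

  W-suc≅Ext : ∀ {n} → OrderIso (W m (suc n)) (Ext n (not (n ≡ᵇ 0)) m)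
  W-suc≅Ext {n} = record
    { f       = λ w → (initW w , letter w (fromℕ n)) , last-admissible w
    ; mono    = λ _ _ w⊑w′ → (λ i → w⊑w′ (inject₁ i)) , w⊑w′ (fromℕ n)
    ; reflect = λ w w′ (init⊑ , last≤) i → reflect {w} {w′} init⊑ last≤ i (initOrLast i)
    ; onto    = onto
    }
    where
    reflect : ∀ {w w′ : MNWord (suc n)} → initW w ⊑ initW w′ → letter w (fromℕ n) ≤ℕ letter w′ (fromℕ n)
            → ∀ i → InitOrLast i → letter w i ≤ℕ letter w′ i
    reflect init⊑ _     _ (initial j) = init⊑ j
    reflect _     last≤ _ final       = last≤
    onto : ∀ e → ∃ λ w
         → Equivalent (Ext n (not (n ≡ᵇ 0)) m) ((initW w , letter w (fromℕ n)) , last-admissible w) e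
    onto ((u , x) , a) =
      appendW u a , ((λ i → ≤-reflexive (init≡ i)) , ≤-reflexive last≡)
                  , ((λ i → ≤-reflexive (sym (init≡ i))) , ≤-reflexive (sym last≡))
      where
      c : Fin (suc (suc m))
      c = letter-of (Admissible⇒≤1+m ≤-refl a)
      init≡ : ∀ i → toℕ (init (proj₁ u ∷ʳ c) i) ≡ letter u i
      init≡ i = cong toℕ (init-∷ʳ (proj₁ u) c i)
      last≡ : toℕ (last (proj₁ u ∷ʳ c)) ≡ x
      last≡ = trans (cong toℕ (last-∷ʳ (proj₁ u) c)) (toℕ-letter-of (Admissible⇒≤1+m ≤-refl a))

  W₀-IC : IntervalConstructable (W m 0)
  W₀-IC = One , base , record
    { f       = λ _ → tt
    ; mono    = λ _ _ _ → tt
    ; reflect = λ _ _ _ ()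
    ; onto    = λ _ → ((λ ()) , (λ ()) , (λ ())) , tt , tt
    }

  W-IC : ∀ n → IntervalConstructable (W m n)
  W-IC zero    = W₀-IC
  W-IC (suc n) = IntervalConstructable-resp W-suc≅Ext (Ext-IC n _ m ≤-refl (W-IC n))

theorem4p3 : (m n : ℕ) → IntervalConstructable (W m n)
theorem4p3 = W-IC
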